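{- Let $n\ge1$ and let $f=(f_1,\dots,f_n)$ be a finite list of nonzero integers which is symmetric, i.e. $f_k=f_{n+1-k}$ for $1\le k\le n$. Then the triangle $\Delta(f)$ has 3-fold rotational symmetry; explicitly, column $c$ of $\Delta(f)$ equals row $n-c$ of $\Delta(f)$ for every $0\le c\le n$, i.e. $\left[{c+k\atop k}\right]_f=\left[{n-c\atop k}\right]_f$ for all integers $c,k\ge0$ with $c+k\le n$.
   Context: For a finite list $f=(f_1,\dots,f_n)$ of nonzero numbers and integers $0\le k\le m\le n$, $\left[{m\atop k}\right]_f=\dfrac{f_mf_{m-1}\cdots f_{m-k+1}}{f_kf_{k-1}\cdots f_1}$ (equal to $1$ for $k=0$). The triangle $\Delta(f)$ is the triangular array of these numbers, with row $m$ consisting of $\left[{m\atop k}\right]_f$, $0\le k\le m$, and column $c$ consisting of $\left[{c+k\atop c}\right]_f=\left[{c+k\atop k}\right]_f$, $k\ge0$. -}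

module Defs where

open import Data.Nat using (ℕ; zero; suc; _∸_; _<?_)
open import Data.Fin using (Fin; fromℕ<)
open import Data.Integer using (ℤ; 1ℤ; _*_)
open import Data.Rational using (ℚ; _/_; 0ℚ; _÷_; ≢-nonZero)
import Data.Rational as Q
open import Data.Rational.Properties using (_≟_)
open import Relation.Nullary using (yes; no)

-- A finite list f = (f_1,…,f_n) is given as f : Fin n → ℤ, with f_k = f (k-1).
-- 1-based access: at f k = f_k for 1 ≤ k ≤ n (junk value 1 outside this range,
-- never used by the bracket for 0 ≤ k ≤ m ≤ n).
at : ∀ {n} → (Fin n → ℤ) → ℕ → ℤ
at f zero = 1ℤ
at {n} f (suc k) with k <? n
... | yes k<n = f (fromℕ< k<n)
... | no _    = 1ℤ

fall : ∀ {n} → (Fin n → ℤ) → ℕ → ℕ → ℤ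
fall f m zero    = 1ℤ
fall f m (suc k) = at f m * fall f (m ∸ 1) k

-- total division on ℚ (equals the usual quotient whenever q ≢ 0)
_÷'_ : ℚ → ℚ → ℚ
p ÷' q with q ≟ 0ℚ
... | yes _  = 0ℚ
... | no q≢0 = _÷_ p q {{≢-nonZero q≢0}}

bracket : ∀ {n} → (Fin n → ℤ) → ℕ → ℕ → ℚ
bracket f m k = (fall f m k / 1) ÷' (fall f k k / 1)

-- The denominators of both brackets are the same product f_k ⋯ f_1, so only the
-- numerators must agree. Read upwards, the numerator of [c+k k]_f is
-- f_{c+1} ⋯ f_{c+k}; read downwards, that of [n-c k]_f is f_{n-c} ⋯ f_{n-c-k+1};
-- symmetry f_{c+1+i} = f_{n-c-i} matches them factor by factor.
module Submission where

open import Defs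
open import Data.Nat using (ℕ; _+_; _∸_; _≤_; _<_; _<?_; suc; zero; s≤s; z≤n)
open import Data.Nat.Properties
  using (+-comm; +-suc; ∸-+-assoc; +-∸-assoc; m+[n∸m]≡n; ∸-monoʳ-<; +-monoʳ-<; <-≤-trans)
open import Data.Fin using (Fin; toℕ; fromℕ<)
open import Data.Fin.Properties using (toℕ-fromℕ<; fromℕ<-cong)
open import Data.Integer using (ℤ; 0ℤ; 1ℤ; _*_)
open import Data.Integer.Properties using (*-comm; *-assoc; *-identityˡ; *-identityʳ)
open import Data.Rational using (_/_)
open import Relation.Binary.PropositionalEquality
open import Relation.Nullary using (yes; no)
open import Relation.Nullary.Negation using (contradiction)

product : (ℕ → ℤ) → ℕ → ℤ
product u zero    = 1ℤ
product u (suc k) = u 0 * product (λ i → u (suc i)) k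

product-cong : ∀ (u v : ℕ → ℤ) k → (∀ i → i < k → u i ≡ v i) → product u k ≡ product v k
product-cong u v zero    _   = refl
product-cong u v (suc k) u≗v =
  cong₂ _*_ (u≗v 0 (s≤s z≤n)) (product-cong _ _ k (λ i i<k → u≗v (suc i) (s≤s i<k)))

product-suc : ∀ u k → product u (suc k) ≡ product u k * u k
product-suc u zero    = trans (*-identityʳ (u 0)) (sym (*-identityˡ (u 0)))
product-suc u (suc k) =
  trans (cong (u 0 *_) (product-suc (λ i → u (suc i)) k)) (sym (*-assoc (u 0) _ _))

fall≡product-descending : ∀ {n} (f : Fin n → ℤ) m k → fall f m k ≡ product (λ i → at f (m ∸ i)) k
fall≡product-descending f m zero    = refl
fall≡product-descending f m (suc k) = cong (at f m *_) (trans (fall≡product-descending f (m ∸ 1) k)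
  (product-cong _ _ k (λ i _ → cong (at f) (∸-+-assoc m 1 i))))

fall≡product-ascending : ∀ {n} (f : Fin n → ℤ) m k →
                         fall f (m + k) k ≡ product (λ i → at f (suc (m + i))) k
fall≡product-ascending f m zero    = refl
fall≡product-ascending f m (suc k) = begin
  fall f (m + suc k) (suc k)             ≡⟨ cong (λ x → fall f x (suc k)) (+-suc m k) ⟩
  at f (suc (m + k)) * fall f (m + k) k  ≡⟨ cong (at f (suc (m + k)) *_) (fall≡product-ascending f m k) ⟩
  at f (suc (m + k)) * product u k       ≡⟨ *-comm (at f (suc (m + k))) _ ⟩
  product u k * u k                      ≡⟨ product-suc u k ⟨
  product u (suc k)                      ∎
  where
  open ≡-Reasoning
  u : ℕ → ℤ
  u i = at f (suc (m + i))

at-suc : ∀ {n} (f : Fin n → ℤ) m (m<n : m < n) → at f (suc m) ≡ f (fromℕ< m<n)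
at-suc {n} f m m<n with m <? n
... | yes m<n′ = cong f (fromℕ<-cong m m refl m<n′ m<n)
... | no  m≮n  = contradiction m<n m≮n

Palindromic : ∀ {n} → (Fin n → ℤ) → Set
Palindromic {n} f = ∀ (i j : Fin n) → toℕ i + toℕ j + 1 ≡ n → f i ≡ f j

at-palindromic : ∀ {n} (f : Fin n → ℤ) → Palindromic f → ∀ m → m < n → at f (suc m) ≡ at f (n ∸ m)
at-palindromic {n} f palindromic m m<n = begin
  at f (suc m)              ≡⟨ at-suc f m m<n ⟩
  f (fromℕ< m<n)            ≡⟨ palindromic _ _ indices-sum ⟩
  f (fromℕ< mirror<n)       ≡⟨ at-suc f (n ∸ suc m) mirror<n ⟨
  at f (suc (n ∸ suc m))    ≡⟨ cong (at f) (+-∸-assoc 1 m<n) ⟨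
  at f (n ∸ m)              ∎
  where
  open ≡-Reasoning
  mirror<n : n ∸ suc m < n
  mirror<n = ∸-monoʳ-< (s≤s z≤n) m<n
  indices-sum : toℕ (fromℕ< m<n) + toℕ (fromℕ< mirror<n) + 1 ≡ n
  indices-sum rewrite toℕ-fromℕ< m<n | toℕ-fromℕ< mirror<n =
    trans (+-comm (m + (n ∸ suc m)) 1) (m+[n∸m]≡n m<n)

fall-palindromic : ∀ {n} (f : Fin n → ℤ) → Palindromic f →
                   ∀ c k → c + k ≤ n → fall f (c + k) k ≡ fall f (n ∸ c) k
fall-palindromic {n} f palindromic c k c+k≤n = begin
  fall f (c + k) k                           ≡⟨ fall≡product-ascending f c k ⟩
  product (λ i → at f (suc (c + i))) k       ≡⟨ product-cong _ _ k mirror ⟩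
  product (λ i → at f (n ∸ c ∸ i)) k         ≡⟨ fall≡product-descending f (n ∸ c) k ⟨
  fall f (n ∸ c) k                           ∎
  where
  open ≡-Reasoning
  mirror : ∀ i → i < k → at f (suc (c + i)) ≡ at f (n ∸ c ∸ i)
  mirror i i<k = trans (at-palindromic f palindromic (c + i) (<-≤-trans (+-monoʳ-< c i<k) c+k≤n))
                       (cong (at f) (sym (∸-+-assoc n c i)))

-- Both brackets share the denominator fall f k k.
lemma2p2 : (n : ℕ) → 1 ≤ n → (f : Fin n → ℤ) → (∀ i → f i ≢ 0ℤ)
    → (∀ (i j : Fin n) → toℕ i + toℕ j + 1 ≡ n → f i ≡ f j)
    → ∀ (c k : ℕ) → c + k ≤ n → bracket f (c + k) k ≡ bracket f (n ∸ c) k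
lemma2p2 n _ f _ palindromic c k c+k≤n =
  cong (λ numerator → (numerator / 1) ÷' (fall f k k / 1)) (fall-palindromic f palindromic c k c+k≤n)
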